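{- For every integer $n \ge 4$, the graphs $D_n$ and $U_n$ are not isomorphic.
   Context: For $n \ge 0$, the $132$-core $D_n$ is the simple graph with vertex set $\{(i,j) : 1 \le i \le j \le n\}$, where $(i,j)$ and $(k,\ell)$ are adjacent if and only if either $i < k \le j < \ell$, or $k < i \le \ell < j$. The $123$-core $U_n$ is the simple graph with the same vertex set $\{(i,j) : 1 \le i \le j \le n\}$, where $(i,j)$ and $(k,\ell)$ are adjacent if and only if either ($k < i$ and $j < \ell$) or ($i < k$ and $\ell < j$). -}

module Defs where

open import Data.Nat using (ℕ; _≤_; _<_)
open import Data.Product using (Σ; _×_; _,_; proj₁)
open import Data.Sum using (_⊎_)
open import Function.Bundles using (Bijection; _⤖_)
open import Level using (0ℓ)

Vertex : ℕ → Set
Vertex n = Σ (ℕ × ℕ) λ { (i , j) → (1 ≤ i) × (i ≤ j) × (j ≤ n) }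

Adj : ℕ → Set₁
Adj n = Vertex n → Vertex n → Set

D-adj : (n : ℕ) → Adj n
D-adj n ((i , j) , _) ((k , l) , _) =
  ((i < k) × (k ≤ j) × (j < l)) ⊎ ((k < i) × (i ≤ l) × (l < j))

U-adj : (n : ℕ) → Adj n
U-adj n ((i , j) , _) ((k , l) , _) =
  ((k < i) × (j < l)) ⊎ ((i < k) × (l < j))

record GraphIso {n : ℕ} (G H : Adj n) : Set where
  field
    bij       : Vertex n ⤖ Vertex n
  f : Vertex n → Vertex n
  f = Bijection.to bij
  field
    preserves : ∀ u v → G u v → H (f u) (f v)
    reflects  : ∀ u v → H (f u) (f v) → G u v

-- Count isolated vertices. In D_n every diagonal vertex (m,m) and the vertex (1,n) is
-- isolated, which gives five of them once n ≥ 4. In U_n a vertex (i,j) with j ≥ i+2 is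
-- adjacent to (i+1,i+1), and one with i > 1 and j < n is adjacent to (i-1,j+1), so the only
-- isolated vertices are (1,1), (1,2), (n-1,n) and (n,n). An isomorphism maps isolated
-- vertices injectively to isolated vertices, and 5 > 4.
module Submission where

open import Defs
open import Data.Nat using (ℕ; zero; suc; _∸_; _≤_; z≤n; s≤s; _≟_)
open import Data.Nat.Properties
open import Data.Fin using (Fin; zero; suc; toℕ)
open import Data.Fin.Properties using (toℕ<n; toℕ-injective; injective⇒≤)
open import Data.Product using (Σ; _×_; _,_; proj₁; proj₂)
open import Data.Empty using (⊥-elim)
open import Data.Sum using (_⊎_; inj₁; inj₂)
open import Function.Base using (_∘_)
open import Function.Bundles using (Bijection)
open import Function.Definitions using (Injective)
open import Relation.Nullary using (¬_; yes; no)
open import Relation.Binary.PropositionalEquality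

Isolated : ∀ {n} → Adj n → Vertex n → Set
Isolated G u = ∀ v → ¬ G u v

Vertex-≡ : ∀ {n} {u v : Vertex n} → proj₁ u ≡ proj₁ v → u ≡ v
Vertex-≡ {u = _ , a , b , c} {_ , a′ , b′ , c′} refl
  rewrite ≤-irrelevant a a′ | ≤-irrelevant b b′ | ≤-irrelevant c c′ = refl

isolated-preserved : ∀ {n} {G H : Adj n} (iso : GraphIso G H) {u : Vertex n} →
                     Isolated G u → Isolated H (GraphIso.f iso u)
isolated-preserved iso {u} isolated w u~w
  with v , refl ← Bijection.strictlySurjective (GraphIso.bij iso) w
  = isolated v (GraphIso.reflects iso u v u~w)

isolated-injection : ∀ {n a b} {G H : Adj n} → GraphIso G H →
  (e : Fin a → Vertex n) → Injective _≡_ _≡_ e → (∀ k → Isolated G (e k)) →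
  (code : ∀ u → Isolated H u → Fin b) →
  (∀ {u v} iu iv → code u iu ≡ code v iv → u ≡ v) →
  a ≤ b
isolated-injection iso e e-injective e-isolated code code-injective =
  injective⇒≤ code∘f∘e-injective
  where
  open GraphIso iso using (f; bij)

  code∘f∘e : Fin _ → Fin _
  code∘f∘e k = code (f (e k)) (isolated-preserved iso (e-isolated k))

  code∘f∘e-injective : Injective _≡_ _≡_ code∘f∘e
  code∘f∘e-injective = e-injective ∘ Bijection.injective bij ∘ code-injective _ _

diagonal : ∀ {n} m → 1 ≤ m → m ≤ n → Vertex n
diagonal m 1≤m m≤n = (m , m) , 1≤m , ≤-refl , m≤n

full : ∀ {n} → 1 ≤ n → Vertex n
full 1≤n = (1 , _) , ≤-refl , 1≤n , ≤-refl

D-diagonal-isolated : ∀ {n m} (1≤m : 1 ≤ m) (m≤n : m ≤ n) →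
                      Isolated (D-adj n) (diagonal m 1≤m m≤n)
D-diagonal-isolated _ _ _ (inj₁ (m<k , k≤m , _))  = <⇒≱ m<k k≤m
D-diagonal-isolated _ _ _ (inj₂ (_ , m≤l , l<m)) = <⇒≱ l<m m≤l

D-full-isolated : ∀ {n} (1≤n : 1 ≤ n) → Isolated (D-adj n) (full 1≤n)
D-full-isolated _ (_ , _ , _ , l≤n)  (inj₁ (_ , _ , n<l)) = <⇒≱ n<l l≤n
D-full-isolated _ (_ , 1≤k , _)      (inj₂ (k<1 , _))     = <⇒≱ k<1 1≤k

full≢diagonal : ∀ {n m} → 2 ≤ n → ¬ (1 , n) ≡ (m , m)
full≢diagonal (s≤s (s≤s _)) ()

D-isolated₅ : ∀ {n} → 4 ≤ n → Fin 5 → Vertex n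
D-isolated₅ 4≤n zero    = full (≤-trans (s≤s z≤n) 4≤n)
D-isolated₅ 4≤n (suc k) = diagonal (suc (toℕ k)) (s≤s z≤n) (≤-trans (toℕ<n k) 4≤n)

D-isolated₅-isolated : ∀ {n} (4≤n : 4 ≤ n) k → Isolated (D-adj n) (D-isolated₅ 4≤n k)
D-isolated₅-isolated 4≤n zero    = D-full-isolated (≤-trans (s≤s z≤n) 4≤n)
D-isolated₅-isolated 4≤n (suc k) = D-diagonal-isolated (s≤s z≤n) (≤-trans (toℕ<n k) 4≤n)

D-isolated₅-injective : ∀ {n} (4≤n : 4 ≤ n) → Injective _≡_ _≡_ (D-isolated₅ 4≤n)
D-isolated₅-injective 4≤n {zero}  {zero}   _  = refl
D-isolated₅-injective 4≤n {suc k} {suc k′} eq =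
  cong suc (toℕ-injective (suc-injective (cong (proj₁ ∘ proj₁) eq)))
D-isolated₅-injective 4≤n {zero}  {suc _}  eq =
  ⊥-elim (full≢diagonal (≤-trans (s≤s (s≤s z≤n)) 4≤n) (cong proj₁ eq))
D-isolated₅-injective 4≤n {suc k} {zero}   eq =
  sym (D-isolated₅-injective 4≤n {zero} {suc k} (sym eq))

U-isolated⇒j≤1+i : ∀ {n i j} {p} → Isolated (U-adj n) ((i , j) , p) → j ≤ suc i
U-isolated⇒j≤1+i {p = _ , _ , j≤n} isolated = ≮⇒≥ λ 1+i<j →
  isolated ((_ , _) , s≤s z≤n , ≤-refl , ≤-trans (<⇒≤ 1+i<j) j≤n) (inj₂ (≤-refl , 1+i<j))

U-isolated⇒i≡1⊎j≡n : ∀ {n i j} {p} → Isolated (U-adj n) ((i , j) , p) → i ≡ 1 ⊎ j ≡ n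
U-isolated⇒i≡1⊎j≡n {i = 1} _ = inj₁ refl
U-isolated⇒i≡1⊎j≡n {n} {suc (suc i)} {j} {p = _ , 2+i≤j , j≤n} isolated with j ≟ n
... | yes j≡n = inj₂ j≡n
... | no  j≢n = ⊥-elim (isolated ((suc i , suc j) , s≤s z≤n , 1+i≤1+j , ≤∧≢⇒< j≤n j≢n)
                                 (inj₁ (≤-refl , ≤-refl)))
  where
  1+i≤1+j : suc i ≤ suc j
  1+i≤1+j = ≤-trans (n≤1+n (suc i)) (m≤n⇒m≤1+n 2+i≤j)

U-candidate : ℕ → Fin 4 → ℕ × ℕ
U-candidate n zero                   = 1 , 1
U-candidate n (suc zero)             = 1 , 2
U-candidate n (suc (suc zero))       = n ∸ 1 , n
U-candidate n (suc (suc (suc zero))) = n , n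

candidate-cases : ∀ {n i j} → i ≤ j → j ≤ suc i → i ≡ 1 ⊎ j ≡ n →
                  Σ (Fin 4) λ t → (i , j) ≡ U-candidate n t
candidate-cases {j = 0}                 () _              (inj₁ refl)
candidate-cases {j = 1}                 _  _              (inj₁ refl) = zero , refl
candidate-cases {j = 2}                 _  _              (inj₁ refl) = suc zero , refl
candidate-cases {j = suc (suc (suc _))} _  (s≤s (s≤s ())) (inj₁ refl)
candidate-cases {i = i} {j} i≤j j≤1+i (inj₂ refl) with i ≟ j
... | yes refl = suc (suc (suc zero)) , refl
... | no  i≢j with refl ← ≤-antisym j≤1+i (≤∧≢⇒< i≤j i≢j) = suc (suc zero) , refl

U-isolated⇒candidate : ∀ {n} (u : Vertex n) → Isolated (U-adj n) u →
                       Σ (Fin 4) λ t → proj₁ u ≡ U-candidate n t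
U-isolated⇒candidate (_ , p@(_ , i≤j , _)) isolated =
  candidate-cases i≤j (U-isolated⇒j≤1+i {p = p} isolated)
                      (U-isolated⇒i≡1⊎j≡n {p = p} isolated)

U-candidate-index : ∀ {n} (u : Vertex n) → Isolated (U-adj n) u → Fin 4
U-candidate-index u isolated = proj₁ (U-isolated⇒candidate u isolated)

U-candidate-index-injective : ∀ {n} {u v : Vertex n} iu iv →
  U-candidate-index u iu ≡ U-candidate-index v iv → u ≡ v
U-candidate-index-injective {_} {u} {v} iu iv same-index = Vertex-≡ (begin
  proj₁ u                                ≡⟨ proj₂ (U-isolated⇒candidate u iu) ⟩
  U-candidate _ (U-candidate-index u iu) ≡⟨ cong (U-candidate _) same-index ⟩
  U-candidate _ (U-candidate-index v iv) ≡⟨ proj₂ (U-isolated⇒candidate v iv) ⟨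
  proj₁ v                                ∎)
  where open ≡-Reasoning

mainTheorem4 : (n : ℕ) → 4 ≤ n → ¬ GraphIso (D-adj n) (U-adj n)
mainTheorem4 n 4≤n iso = 1+n≰n five≤four
  where
  five≤four : 5 ≤ 4
  five≤four = isolated-injection iso
    (D-isolated₅ 4≤n) (D-isolated₅-injective 4≤n) (D-isolated₅-isolated 4≤n)
    U-candidate-index U-candidate-index-injective
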